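{- Let $G=(A,B,E)$ be a MinRep instance and let $\overline{G}$ be the PDS instance constructed from it as described in the context. Let $A^*\subseteq A$ and $B^*\subseteq B$. Then $A^*\cup B^*$ is an optimal solution of the MinRep instance $G$ if and only if $S^*=A^*\cup B^*\cup\{w^*\}\subseteq V(\overline{G})$ is an optimal solution of the PDS instance $\overline{G}$ (i.e. a minimum-size set power dominating $\overline{G}$).
   Context: Power domination: for an undirected graph $H=(V,E)$ and $S\subseteq V$, the set $\mathcal{P}_S$ is obtained by (Rule 1) putting every node of $S$ and every neighbor of a node of $S$ into $\mathcal{P}_S$, and (Rule 2) repeatedly: if $v\in\mathcal{P}_S$ and all neighbors of $v$ except exactly one neighbor $w$ are in $\mathcal{P}_S$, insert $w$. $S$ power dominates $H$ if $\mathcal{P}_S=V$; the PDS problem asks for a minimum-size such $S$. MinRep: we are given a bipartite graph $G=(A,B,E)$ together with partitions $A=A_1\cup\cdots\cup A_{q_A}$ and $B=B_1\cup\cdots\cup B_{q_B}$ into equal-sized subsets. There is a super edge $A_iB_j$ if some $a\in A_i$, $b\in B_j$ satisfy $ab\in E$. A set $S\subseteq A\cup B$ covers the super edge $A_iB_j$ if there exist $a\in S\cap A_i$, $b\in S\cap B_j$ with $ab\in E$. The MinRep problem asks for a minimum-size set $A'\cup B'$ ($A'\subseteq A$, $B'\subseteq B$) covering all super edges. Construction of $\overline{G}$: take a copy of each node of $A\cup B$ (same names); add a node $w^*$ adjacent to all nodes of $A\cup B$, and three further nodes $w^*_1,w^*_2,w^*_3$ each adjacent only to $w^*$. For every super edge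 $A_iB_j$, let $E_{ij}=\{e_1,\dots,e_{\ell_{ij}}\}$ be the set of edges of $G$ between $A_i$ and $B_j$, and let $C_{ij}$ be a cycle on $3\ell_{ij}$ nodes labeled in cyclic order $u_1,v_1,w_1,u_2,v_2,w_2,\dots,u_{\ell_{ij}},v_{\ell_{ij}},w_{\ell_{ij}}$. Add $4$ disjoint copies of $C_{ij}$, and for each $e_k=a_kb_k\in E_{ij}$ ($a_k\in A_i$, $b_k\in B_j$) and each of the 4 copies, add an edge from $a_k$ to $u_k$ and an edge from $b_k$ to $v_k$ of that copy. $\overline{G}$ is the resulting undirected graph. -}

module Defs where

open import Data.Nat using (ℕ; zero; suc; _+_; _≤_)
open import Data.Fin using (Fin; toℕ)
open import Data.Bool using (Bool; true; false)
open import Data.List using (List; []; _∷_; length; filterᵇ; cartesianProduct; allFin; lookup; map; _++_)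
open import Data.List.Membership.Propositional using (_∈_)
open import Data.List.Relation.Unary.Unique.Propositional using (Unique)
open import Data.Product using (_×_; _,_; proj₁; proj₂; Σ; ∃)
open import Data.Sum using (_⊎_)
open import Relation.Binary.PropositionalEquality using (_≡_; _≢_)

-- A = Fin qA × Fin sA with A_i = {i} × Fin sA (qA parts of equal size sA);
-- likewise B = Fin qB × Fin sB.

record MinRep : Set where
  field
    qA sA qB sB : ℕ
    E : Fin qA × Fin sA → Fin qB × Fin sB → Bool

module _ (I : MinRep) where
  open MinRep I

  NodeA : Set
  NodeA = Fin qA × Fin sA

  NodeB : Set
  NodeB = Fin qB × Fin sB

  Edge : NodeA → NodeB → Set
  Edge a b = E a b ≡ true

  SuperEdge : Fin qA → Fin qB → Set
  SuperEdge i j = Σ (Fin sA) λ a → Σ (Fin sB) λ b → Edge (i , a) (j , b)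

  Covers : List NodeA → List NodeB → Fin qA → Fin qB → Set
  Covers As Bs i j = Σ (Fin sA) λ a → Σ (Fin sB) λ b →
    ((i , a) ∈ As) × ((j , b) ∈ Bs) × Edge (i , a) (j , b)

  CoversAll : List NodeA → List NodeB → Set
  CoversAll As Bs = ∀ i j → SuperEdge i j → Covers As Bs i j

  -- optimal MinRep solution A* ∪ B* (subsets given as duplicate-free lists)
  OptMinRep : List NodeA → List NodeB → Set
  OptMinRep As Bs = CoversAll As Bs ×
    (∀ (As' : List NodeA) (Bs' : List NodeB) → Unique As' → Unique Bs' →
       CoversAll As' Bs' → length As + length Bs ≤ length As' + length Bs')

  -- The graph Ḡ.
  -- E_ij = e_1, …, e_ℓij : the edges between A_i and B_j, enumerated in
  -- lexicographic order of (a , b).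
  Eij : Fin qA → Fin qB → List (Fin sA × Fin sB)
  Eij i j = filterᵇ (λ p → E (i , proj₁ p) (j , proj₂ p))
                    (cartesianProduct (allFin sA) (allFin sB))

  ℓ : Fin qA → Fin qB → ℕ
  ℓ i j = length (Eij i j)

  data Pos : Set where
    pu pv pw : Pos

  data Node : Set where
    nA    : Fin qA → Fin sA → Node
    nB    : Fin qB → Fin sB → Node
    wstar : Node
    wl    : Fin 3 → Node
    -- node u_k / v_k / w_k (by Pos) of copy c ∈ {1..4} of C_ij
    cyc   : (i : Fin qA) (j : Fin qB) → Fin 4 → Fin (ℓ i j) → Pos → Node

  CycSucc : (n : ℕ) → Fin n → Fin n → Set
  CycSucc n k k' = (suc (toℕ k) ≡ toℕ k') ⊎ ((suc (toℕ k) ≡ n) × (toℕ k' ≡ 0))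

  -- generating (directed) edges; the graph is their symmetric closure
  data D : Node → Node → Set where
    d-wA  : ∀ i a → D wstar (nA i a)
    d-wB  : ∀ j b → D wstar (nB j b)
    d-wl  : ∀ t → D wstar (wl t)
    d-uv  : ∀ i j c k → D (cyc i j c k pu) (cyc i j c k pv)
    d-vw  : ∀ i j c k → D (cyc i j c k pv) (cyc i j c k pw)
    d-wu  : ∀ i j c k k' → CycSucc (ℓ i j) k k' → D (cyc i j c k pw) (cyc i j c k' pu)
    d-au  : ∀ i j c k → D (nA i (proj₁ (lookup (Eij i j) k))) (cyc i j c k pu)
    d-bv  : ∀ i j c k → D (nB j (proj₂ (lookup (Eij i j) k))) (cyc i j c k pv)

  Adj : Node → Node → Set
  Adj x y = D x y ⊎ D y x

  data Observed (S : List Node) : Node → Set where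
    rule1-self : ∀ {v} → v ∈ S → Observed S v
    rule1-nbr  : ∀ {u v} → u ∈ S → Adj u v → Observed S v
    rule2      : ∀ {v w} → Observed S v → Adj v w →
                 (∀ x → Adj v x → x ≢ w → Observed S x) → Observed S w

  PowerDominates : List Node → Set
  PowerDominates S = ∀ v → Observed S v

  OptPDS : List Node → Set
  OptPDS S = Unique S × PowerDominates S ×
    (∀ (S' : List Node) → Unique S' → PowerDominates S' → length S ≤ length S')

  Sstar : List NodeA → List NodeB → List Node
  Sstar As Bs = map (λ p → nA (proj₁ p) (proj₂ p)) As
             ++ map (λ p → nB (proj₁ p) (proj₂ p)) Bs ++ wstar ∷ []

-- A node of Ḡ other than w* and its leaves stands for at most one node of a MinRep solution:
-- a node of A ∪ B for itself, and a node of copy 1 or 2 (copy 3 or 4) of C_ij for the A-end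
-- (B-end) of the first edge of E_ij. If S contains both ends of no edge of E_ij and misses
-- two copies of C_ij entirely, these copies carry a fort, so S does not power dominate; the
-- three leaves of w* form another fort. Hence the projection of a power dominating set covers
-- every super edge and is strictly smaller than it. Conversely, w* observes A ∪ B, and an
-- edge e_k with both ends in S starts the forcing u_k, v_k, w_k, u_(k+1), … around every copy
-- of C_ij, so S* power dominates as soon as A* ∪ B* covers. As |S*| = 1 + |A*| + |B*|, the two
-- optimality notions coincide.
module Submission where

open import Defs
open import Data.Bool using (T?)
open import Data.Bool.Properties using (T-≡)
open import Data.Empty using (⊥; ⊥-elim)
open import Data.Fin as Fin using (Fin; zero; suc; fromℕ; inject₁)
open import Data.Fin.Induction using (<-weakInduction; <-weakInduction-startingFrom)
open import Data.Fin.Properties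
  using (toℕ-injective; toℕ<n; toℕ-fromℕ; toℕ-inject₁; ≤fromℕ; any?)
open import Data.List using (List; []; _∷_; length; lookup; deduplicate; cartesianProduct; allFin)
open import Data.List.Membership.Propositional using (_∈_; _∉_; lose)
open import Data.List.Membership.Propositional.Properties
  using (∈-filter⁺; ∈-filter⁻; ∈-lookup; ∈-cartesianProduct⁺; ∈-allFin; ∈-deduplicate⁺)
import Data.List.Membership.DecPropositional as DecMembership
open import Data.List.Relation.Binary.Subset.Propositional using (_⊆_)
open import Data.List.Relation.Unary.All.Properties using (¬Any⇒All¬)
open import Data.List.Relation.Unary.AllPairs using ([]; _∷_)
open import Data.List.Relation.Unary.Any as Any using (Any; here; there; index)
open import Data.List.Relation.Unary.Any.Properties using (lookup-index)
open import Data.List.Relation.Unary.Unique.Propositional using (Unique)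
open import Data.List.Relation.Unary.Unique.Propositional.Properties using (Unique[x∷xs]⇒x∉xs)
open import Data.List.Relation.Unary.Unique.DecPropositional.Properties using (deduplicate-!)
open import Data.List.Properties using (length-deduplicate)
open import Data.Maybe using (Maybe; just; nothing)
open import Data.Nat using (suc; _+_; _≤_; _<_; z≤n; s≤s)
open import Data.Nat.Properties
  using (suc-injective; <⇒≢; +-suc; ≤-trans; ≤-reflexive; m≤n⇒m≤1+n; +-mono-≤; ≤-pred)
open import Data.Product using (_×_; _,_; proj₁; proj₂; ∃-syntax)
open import Data.Product.Properties using (≡-dec)
open import Data.Sum using (_⊎_; inj₁; inj₂)
open import Function.Bundles using (_⇔_; mk⇔; Equivalence)
open import Relation.Binary.Definitions using (DecidableEquality)
open import Relation.Binary.PropositionalEquality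
  using (_≡_; _≢_; refl; sym; trans; cong; subst; subst₂)
open import Relation.Nullary using (¬_; Dec; yes; no)
open import Relation.Nullary.Decidable using (_×-dec_)

module _ {X A B : Set} (role : X → Maybe (A ⊎ B)) where

  sideA : List X → List A
  sideA [] = []
  sideA (x ∷ xs) with role x
  ... | just (inj₁ a) = a ∷ sideA xs
  ... | _             = sideA xs

  sideB : List X → List B
  sideB [] = []
  sideB (x ∷ xs) with role x
  ... | just (inj₂ b) = b ∷ sideB xs
  ... | _             = sideB xs

  ∈-sideA : ∀ {x a xs} → x ∈ xs → role x ≡ just (inj₁ a) → a ∈ sideA xs
  ∈-sideA (here refl) eq rewrite eq = here refl
  ∈-sideA {xs = y ∷ _} (there x∈xs) eq with role y
  ... | just (inj₁ _) = there (∈-sideA x∈xs eq)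
  ... | just (inj₂ _) = ∈-sideA x∈xs eq
  ... | nothing       = ∈-sideA x∈xs eq

  ∈-sideB : ∀ {x b xs} → x ∈ xs → role x ≡ just (inj₂ b) → b ∈ sideB xs
  ∈-sideB (here refl) eq rewrite eq = here refl
  ∈-sideB {xs = y ∷ _} (there x∈xs) eq with role y
  ... | just (inj₁ _) = ∈-sideB x∈xs eq
  ... | just (inj₂ _) = there (∈-sideB x∈xs eq)
  ... | nothing       = ∈-sideB x∈xs eq

  length-sides-∷ : ∀ x xs → length (sideA (x ∷ xs)) + length (sideB (x ∷ xs))
                            ≤ suc (length (sideA xs) + length (sideB xs))
  length-sides-∷ x xs with role x
  ... | just (inj₁ _) = ≤-reflexive refl
  ... | just (inj₂ _) = ≤-reflexive (+-suc _ _)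
  ... | nothing       = m≤n⇒m≤1+n (≤-reflexive refl)

  length-sides : ∀ xs → length (sideA xs) + length (sideB xs) ≤ length xs
  length-sides []       = z≤n
  length-sides (x ∷ xs) = ≤-trans (length-sides-∷ x xs) (s≤s (length-sides xs))

  length-sides-< : ∀ xs → Any (λ x → role x ≡ nothing) xs →
                   length (sideA xs) + length (sideB xs) < length xs
  length-sides-< (x ∷ xs) (here eq) rewrite eq = s≤s (length-sides xs)
  length-sides-< (x ∷ xs) (there hub) =
    s≤s (≤-trans (length-sides-∷ x xs) (length-sides-< xs hub))

∉⇒Unique-∷ : ∀ {A : Set} {x : A} {xs} → x ∉ xs → Unique xs → Unique (x ∷ xs)
∉⇒Unique-∷ x∉xs u = ¬Any⇒All¬ _ x∉xs ∷ u

-- The argument only witnesses that Fin n is inhabited.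
first : ∀ {n} → Fin n → Fin n
first {suc n} _ = zero

first-constant : ∀ {n} (k k' : Fin n) → first k ≡ first k'
first-constant {suc n} _ _ = refl

module _ (I : MinRep) where
  open MinRep I

  record Fort (S : List (Node I)) (U : Node I → Set) : Set where
    field
      disjoint : ∀ {x} → U x → x ∉ S
      unwatched : ∀ {u x} → U x → u ∈ S → ¬ Adj I u x
      two-neighbours : ∀ {v w} → ¬ U v → U w → Adj I v w → ∃[ x ] Adj I v x × x ≢ w × U x

  -- Rule 2 never fires into a fort: any neighbour outside it has a second neighbour inside.
  fort-unobserved : ∀ {S U} → Fort S U → ∀ {x} → Observed I S x → ¬ U x
  fort-unobserved F (rule1-self x∈S) Ux = Fort.disjoint F Ux x∈S
  fort-unobserved F (rule1-nbr u∈S adj) Ux = Fort.unwatched F Ux u∈S adj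
  fort-unobserved F (rule2 obs adj rest) Uw
    with Fort.two-neighbours F (fort-unobserved F obs) Uw adj
  ... | x , adjx , x≢w , Ux = fort-unobserved F (rest x adjx x≢w) Ux

  cycSucc-functional : ∀ {n} {k k₁ k₂ : Fin n} →
                       CycSucc I n k k₁ → CycSucc I n k k₂ → k₁ ≡ k₂
  cycSucc-functional (inj₁ e₁) (inj₁ e₂) = toℕ-injective (trans (sym e₁) e₂)
  cycSucc-functional {k₁ = k₁} (inj₁ e₁) (inj₂ (e₂ , _)) =
    ⊥-elim (<⇒≢ (toℕ<n k₁) (trans (sym e₁) e₂))
  cycSucc-functional {k₂ = k₂} (inj₂ (e₁ , _)) (inj₁ e₂) =
    ⊥-elim (<⇒≢ (toℕ<n k₂) (trans (sym e₂) e₁))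
  cycSucc-functional (inj₂ (_ , z₁)) (inj₂ (_ , z₂)) = toℕ-injective (trans z₁ (sym z₂))

  cycSucc-injective : ∀ {n} {k₁ k₂ k : Fin n} →
                      CycSucc I n k₁ k → CycSucc I n k₂ k → k₁ ≡ k₂
  cycSucc-injective (inj₁ e₁) (inj₁ e₂) = toℕ-injective (suc-injective (trans e₁ (sym e₂)))
  cycSucc-injective (inj₁ e₁) (inj₂ (_ , z)) with () ← trans e₁ z
  cycSucc-injective (inj₂ (_ , z)) (inj₁ e₂) with () ← trans e₂ z
  cycSucc-injective (inj₂ (e₁ , _)) (inj₂ (e₂ , _)) =
    toℕ-injective (suc-injective (trans e₁ (sym e₂)))

  cycSucc-inject₁ : ∀ {n} (k : Fin n) → CycSucc I (suc n) (inject₁ k) (suc k)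
  cycSucc-inject₁ k = inj₁ (cong suc (toℕ-inject₁ k))

  cycSucc-fromℕ : ∀ n → CycSucc I (suc n) (fromℕ n) zero
  cycSucc-fromℕ n = inj₂ (cong suc (toℕ-fromℕ n) , refl)

  cycPred : ∀ {n} (k : Fin n) → ∃[ k₀ ] CycSucc I n k₀ k
  cycPred {suc n} zero    = fromℕ n , cycSucc-fromℕ n
  cycPred         (suc k) = inject₁ k , cycSucc-inject₁ k

  cycSucc-induction : ∀ {n} (P : Fin n → Set) → (∀ {k k'} → CycSucc I n k k' → P k → P k') →
                      ∀ {k₀} → P k₀ → ∀ k → P k
  cycSucc-induction {suc n} P step {k₀} Pk₀ =
    <-weakInduction P P-zero (λ k → step (cycSucc-inject₁ k))
    where
      P-last : P (fromℕ n)
      P-last = <-weakInduction-startingFrom P Pk₀ (λ k → step (cycSucc-inject₁ k)) (≤fromℕ k₀)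
      P-zero : P zero
      P-zero = step (cycSucc-fromℕ n) P-last

  edgeA : ∀ i j → Fin (ℓ I i j) → Fin sA
  edgeA i j k = proj₁ (lookup (Eij I i j) k)

  edgeB : ∀ i j → Fin (ℓ I i j) → Fin sB
  edgeB i j k = proj₂ (lookup (Eij I i j) k)

  edge-at : ∀ i j k → Edge I (i , edgeA i j k) (j , edgeB i j k)
  edge-at i j k = Equivalence.to T-≡ (proj₂ (∈-filter⁻ (λ p → T? (E (i , proj₁ p) (j , proj₂ p)))
    {xs = cartesianProduct (allFin sA) (allFin sB)} (∈-lookup k)))

  edge-index : ∀ {i j a b} → Edge I (i , a) (j , b) → ∃[ k ] edgeA i j k ≡ a × edgeB i j k ≡ b
  edge-index {i} {j} {a} {b} e =
    index ab∈Eij , cong proj₁ (sym (lookup-index ab∈Eij)) , cong proj₂ (sym (lookup-index ab∈Eij))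
    where
      ab∈Eij : (a , b) ∈ Eij I i j
      ab∈Eij = ∈-filter⁺ (λ p → T? (E (i , proj₁ p) (j , proj₂ p)))
                 (∈-cartesianProduct⁺ (∈-allFin a) (∈-allFin b)) (Equivalence.from T-≡ e)

  ContainsEdge : List (Node I) → ∀ i j → Fin (ℓ I i j) → Set
  ContainsEdge S i j k = nA i (edgeA i j k) ∈ S × nB j (edgeB i j k) ∈ S

  module _ {S : List (Node I)} (w*∈S : wstar ∈ S) where

    observed-A : ∀ i a → Observed I S (nA i a)
    observed-A i a = rule1-nbr w*∈S (inj₁ (d-wA i a))

    observed-B : ∀ j b → Observed I S (nB j b)
    observed-B j b = rule1-nbr w*∈S (inj₁ (d-wB j b))

    UVObserved : ∀ i j → Fin 4 → Fin (ℓ I i j) → Set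
    UVObserved i j c k = Observed I S (cyc i j c k pu) × Observed I S (cyc i j c k pv)

    observed-w : ∀ {i j c k} → UVObserved i j c k → Observed I S (cyc i j c k pw)
    observed-w {i} {j} {c} {k} (obs-u , obs-v) = rule2 obs-v (inj₁ (d-vw i j c k)) others
      where
        others : ∀ x → Adj I (cyc i j c k pv) x → x ≢ cyc i j c k pw → Observed I S x
        others _ (inj₁ (d-vw _ _ _ _)) x≢w = ⊥-elim (x≢w refl)
        others _ (inj₂ (d-uv _ _ _ _)) _   = obs-u
        others _ (inj₂ (d-bv _ _ _ _)) _   = observed-B _ _

    uvObserved-succ : ∀ {i j c k k'} → CycSucc I (ℓ I i j) k k' →
                      UVObserved i j c k → UVObserved i j c k'
    uvObserved-succ {i} {j} {c} {k} {k'} k→k' uv = obs-u' , obs-v'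
      where
        obs-w : Observed I S (cyc i j c k pw)
        obs-w = observed-w uv
        others-w : ∀ x → Adj I (cyc i j c k pw) x → x ≢ cyc i j c k' pu → Observed I S x
        others-w _ (inj₁ (d-wu _ _ _ _ _ k→k'')) x≢u
          with refl ← cycSucc-functional k→k' k→k'' = ⊥-elim (x≢u refl)
        others-w _ (inj₂ (d-vw _ _ _ _)) _ = proj₂ uv
        obs-u' : Observed I S (cyc i j c k' pu)
        obs-u' = rule2 obs-w (inj₁ (d-wu i j c k k' k→k')) others-w
        others-u : ∀ x → Adj I (cyc i j c k' pu) x → x ≢ cyc i j c k' pv → Observed I S x
        others-u _ (inj₁ (d-uv _ _ _ _)) x≢v = ⊥-elim (x≢v refl)
        others-u _ (inj₂ (d-wu _ _ _ _ _ k''→k')) _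
          with refl ← cycSucc-injective k→k' k''→k' = obs-w
        others-u _ (inj₂ (d-au _ _ _ _)) _ = observed-A _ _
        obs-v' : Observed I S (cyc i j c k' pv)
        obs-v' = rule2 obs-u' (inj₁ (d-uv i j c k')) others-u

    cycle-observed : ∀ {i j} c {k₀} → ContainsEdge S i j k₀ →
                     ∀ k p → Observed I S (cyc i j c k p)
    cycle-observed {i} {j} c {k₀} (a∈S , b∈S) k p =
      at p (cycSucc-induction (UVObserved i j c) uvObserved-succ uv₀ k)
      where
        uv₀ : UVObserved i j c k₀
        uv₀ = rule1-nbr a∈S (inj₁ (d-au i j c k₀)) , rule1-nbr b∈S (inj₁ (d-bv i j c k₀))
        at : ∀ p → UVObserved i j c k → Observed I S (cyc i j c k p)
        at pu = proj₁
        at pv = proj₂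
        at pw = observed-w

    power-dominates-if-edges : (∀ i j → Fin (ℓ I i j) → ∃[ k ] ContainsEdge S i j k) →
                               PowerDominates I S
    power-dominates-if-edges edges (nA i a) = observed-A i a
    power-dominates-if-edges edges (nB j b) = observed-B j b
    power-dominates-if-edges edges wstar    = rule1-self w*∈S
    power-dominates-if-edges edges (wl t)   = rule1-nbr w*∈S (inj₁ (d-wl t))
    power-dominates-if-edges edges (cyc i j c k p) = cycle-observed c (proj₂ (edges i j k)) k p

  cyc-copy-injective : ∀ {i j c c' k k'} {p p' : Pos I} →
                       cyc i j c k p ≡ cyc i j c' k' p' → c ≡ c'
  cyc-copy-injective refl = refl

  -- The fort: the w-nodes of both free copies, and each of their u_k (v_k) whose A-end (B-end)
  -- is outside S. Every pair u_k, v_k meets it since e_k ⊈ S, and an A-node (B-node) outside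
  -- the fort sees its u_k (v_k) in both copies.
  module _ {S : List (Node I)} {i j} {c₁ c₂ : Fin 4} (c₁≢c₂ : c₁ ≢ c₂)
           (no-edge : ∀ k → ¬ ContainsEdge S i j k)
           (c₁-free : ∀ k p → cyc i j c₁ k p ∉ S)
           (c₂-free : ∀ k p → cyc i j c₂ k p ∉ S) where

    private
      Free : Fin 4 → Set
      Free c = c ≡ c₁ ⊎ c ≡ c₂

      other-copy : ∀ {c} → Free c → ∃[ c' ] Free c' × c' ≢ c
      other-copy (inj₁ refl) = c₂ , inj₂ refl , λ c₂≡c₁ → c₁≢c₂ (sym c₂≡c₁)
      other-copy (inj₂ refl) = c₁ , inj₁ refl , c₁≢c₂

      free-copy : ∀ {c} → Free c → ∀ k p → cyc i j c k p ∉ S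
      free-copy (inj₁ refl) = c₁-free
      free-copy (inj₂ refl) = c₂-free

      data Blocked : Node I → Set where
        w-node : ∀ {c} k → Free c → Blocked (cyc i j c k pw)
        u-node : ∀ {c} k → Free c → nA i (edgeA i j k) ∉ S → Blocked (cyc i j c k pu)
        v-node : ∀ {c} k → Free c → nB j (edgeB i j k) ∉ S → Blocked (cyc i j c k pv)

      disjoint : ∀ {x} → Blocked x → x ∉ S
      disjoint (w-node k free)   = free-copy free k pw
      disjoint (u-node k free _) = free-copy free k pu
      disjoint (v-node k free _) = free-copy free k pv

      unwatched : ∀ {u x} → Blocked x → u ∈ S → ¬ Adj I u x
      unwatched (w-node k free)    u∈S (inj₁ (d-vw _ _ _ _))       = free-copy free k pv u∈S
      unwatched (w-node k free)    u∈S (inj₂ (d-wu _ _ _ _ k' _))  = free-copy free k' pu u∈S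
      unwatched (u-node k free _)  u∈S (inj₁ (d-wu _ _ _ k₀ _ _))  = free-copy free k₀ pw u∈S
      unwatched (u-node k free a∉) u∈S (inj₁ (d-au _ _ _ _))       = a∉ u∈S
      unwatched (u-node k free _)  u∈S (inj₂ (d-uv _ _ _ _))       = free-copy free k pv u∈S
      unwatched (v-node k free _)  u∈S (inj₁ (d-uv _ _ _ _))       = free-copy free k pu u∈S
      unwatched (v-node k free b∉) u∈S (inj₁ (d-bv _ _ _ _))       = b∉ u∈S
      unwatched (v-node k free _)  u∈S (inj₂ (d-vw _ _ _ _))       = free-copy free k pw u∈S

      two-neighbours : ∀ {v w} → ¬ Blocked v → Blocked w → Adj I v w →
                       ∃[ x ] Adj I v x × x ≢ w × Blocked x
      two-neighbours _ (v-node k free _) (inj₁ (d-uv _ _ _ _)) =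
        let k₀ , k₀→k = cycPred k
        in _ , inj₂ (d-wu i j _ k₀ k k₀→k) , (λ ()) , w-node k₀ free
      two-neighbours ¬B (w-node k free) (inj₁ (d-vw _ _ _ _)) =
        _ , inj₂ (d-uv i j _ k) , (λ ()) ,
        u-node k free (λ a∈ → ¬B (v-node k free (λ b∈ → no-edge k (a∈ , b∈))))
      two-neighbours ¬B (u-node _ free _) (inj₁ (d-wu _ _ _ k _ _)) = ⊥-elim (¬B (w-node k free))
      two-neighbours _ (u-node k free a∉) (inj₁ (d-au _ _ _ _)) =
        let c' , free' , c'≢c = other-copy free
        in _ , inj₁ (d-au i j c' k) , (λ e → c'≢c (cyc-copy-injective e)) , u-node k free' a∉
      two-neighbours _ (v-node k free b∉) (inj₁ (d-bv _ _ _ _)) =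
        let c' , free' , c'≢c = other-copy free
        in _ , inj₁ (d-bv i j c' k) , (λ e → c'≢c (cyc-copy-injective e)) , v-node k free' b∉
      two-neighbours _ (u-node k free _) (inj₂ (d-uv _ _ _ _)) =
        _ , inj₁ (d-vw i j _ k) , (λ ()) , w-node k free
      two-neighbours ¬B (v-node k free _) (inj₂ (d-vw _ _ _ _)) = ⊥-elim (¬B (w-node k free))
      two-neighbours ¬B (w-node k free) (inj₂ (d-wu _ _ _ _ k' _)) =
        _ , inj₁ (d-uv i j _ k') , (λ ()) ,
        v-node k' free (λ b∈ → ¬B (u-node k' free (λ a∈ → no-edge k' (a∈ , b∈))))

    free-copies-not-dominating : Fin (ℓ I i j) → ¬ PowerDominates I S
    free-copies-not-dominating k pd =
      fort-unobserved blocked-fort (pd (cyc i j c₁ k pw)) (w-node k (inj₁ refl))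
      where
        blocked-fort : Fort S Blocked
        blocked-fort = record { disjoint = disjoint ; unwatched = unwatched ; two-neighbours = two-neighbours }

  role : Node I → Maybe (NodeA I ⊎ NodeB I)
  role (nA i a)                    = just (inj₁ (i , a))
  role (nB j b)                    = just (inj₂ (j , b))
  role wstar                       = nothing
  role (wl _)                      = nothing
  role (cyc i j zero k _)          = just (inj₁ (i , edgeA i j (first k)))
  role (cyc i j (suc zero) k _)    = just (inj₁ (i , edgeA i j (first k)))
  role (cyc i j (suc (suc _)) k _) = just (inj₂ (j , edgeB i j (first k)))

  projectA : List (Node I) → List (NodeA I)
  projectA = sideA role

  projectB : List (Node I) → List (NodeB I)
  projectB = sideB role

  IsHub : Node I → Set
  IsHub x = role x ≡ nothing

  isHub? : ∀ x → Dec (IsHub x)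
  isHub? x with role x
  ... | nothing = yes refl
  ... | just _  = no λ ()

  data Leaf : Node I → Set where
    leaf : ∀ t → Leaf (wl t)

  other-leaf : Fin 3 → Fin 3
  other-leaf zero    = suc zero
  other-leaf (suc _) = zero

  other-leaf-≢ : ∀ t → wl {I} (other-leaf t) ≢ wl t
  other-leaf-≢ zero    ()
  other-leaf-≢ (suc t) ()

  power-dominating-has-hub : ∀ {S} → PowerDominates I S → Any IsHub S
  power-dominating-has-hub {S} pd with Any.any? isHub? S
  ... | yes hub   = hub
  ... | no no-hub = ⊥-elim (fort-unobserved leaves-fort (pd (wl zero)) (leaf zero))
    where
      leaves-fort : Fort S Leaf
      leaves-fort = record
        { disjoint       = λ { (leaf _) wl∈S → no-hub (lose wl∈S refl) }
        ; unwatched      = λ { (leaf _) w∈S (inj₁ (d-wl _)) → no-hub (lose w∈S refl)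
                             ; (leaf _) _ (inj₂ ()) }
        ; two-neighbours = λ { _ (leaf t) (inj₁ (d-wl _)) →
                                 wl (other-leaf t) , inj₁ (d-wl (other-leaf t)) ,
                                 other-leaf-≢ t , leaf (other-leaf t)
                             ; _ (leaf _) (inj₂ ()) } }

  SelectsEdge : List (NodeA I) → List (NodeB I) → ∀ i j → Fin (ℓ I i j) → Set
  SelectsEdge As Bs i j k = (i , edgeA i j k) ∈ As × (j , edgeB i j k) ∈ Bs

  selects⇒covers : ∀ {As Bs i j k} → SelectsEdge As Bs i j k → Covers I As Bs i j
  selects⇒covers {i = i} {j} {k} (a∈ , b∈) = edgeA i j k , edgeB i j k , a∈ , b∈ , edge-at i j k

  covers⇒selects : ∀ {As Bs i j} → Covers I As Bs i j → ∃[ k ] SelectsEdge As Bs i j k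
  covers⇒selects (_ , _ , a∈ , b∈ , e) with edge-index e
  ... | k , refl , refl = k , a∈ , b∈

  CoversAll-mono : ∀ {As As' Bs Bs'} → As ⊆ As' → Bs ⊆ Bs' →
                   CoversAll I As Bs → CoversAll I As' Bs'
  CoversAll-mono As⊆As' Bs⊆Bs' cov i j se =
    let a , b , a∈ , b∈ , e = cov i j se in a , b , As⊆As' a∈ , Bs⊆Bs' b∈ , e

  _≟A_ : DecidableEquality (NodeA I)
  _≟A_ = ≡-dec Fin._≟_ Fin._≟_

  _≟B_ : DecidableEquality (NodeB I)
  _≟B_ = ≡-dec Fin._≟_ Fin._≟_

  open DecMembership _≟A_ using () renaming (_∈?_ to _∈A?_)
  open DecMembership _≟B_ using () renaming (_∈?_ to _∈B?_)

  ∈-projectA-first : ∀ {S i j c k p} (k₀ : Fin (ℓ I i j)) → cyc i j c k p ∈ S →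
                     role (cyc i j c k p) ≡ just (inj₁ (i , edgeA i j (first k))) →
                     (i , edgeA i j (first k₀)) ∈ projectA S
  ∈-projectA-first {k = k} k₀ x∈S eq rewrite first-constant k₀ k = ∈-sideA role x∈S eq

  ∈-projectB-first : ∀ {S i j c k p} (k₀ : Fin (ℓ I i j)) → cyc i j c k p ∈ S →
                     role (cyc i j c k p) ≡ just (inj₂ (j , edgeB i j (first k))) →
                     (j , edgeB i j (first k₀)) ∈ projectB S
  ∈-projectB-first {k = k} k₀ x∈S eq rewrite first-constant k₀ k = ∈-sideB role x∈S eq

  -- If the projection selects no edge of E_ij, then the A-end or the B-end of the first edge
  -- is missing from it, and with it two whole copies of C_ij are missing from S.
  projection-selects : ∀ {S i j} → PowerDominates I S → Fin (ℓ I i j) →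
                       ∃[ k ] SelectsEdge (projectA S) (projectB S) i j k
  projection-selects {S} {i} {j} pd k₀
    with any? (λ k → ((i , edgeA i j k) ∈A? projectA S) ×-dec ((j , edgeB i j k) ∈B? projectB S))
  ... | yes selected = selected
  ... | no none = ⊥-elim (missing-end ((i , edgeA i j (first k₀)) ∈A? projectA S))
    where
      no-edge : ∀ k → ¬ ContainsEdge S i j k
      no-edge k (a∈S , b∈S) = none (k , ∈-sideA role a∈S refl , ∈-sideB role b∈S refl)
      missing-end : Dec ((i , edgeA i j (first k₀)) ∈ projectA S) → ⊥
      missing-end (no a∉) =
        free-copies-not-dominating {c₁ = zero} {suc zero} (λ ()) no-edge
          (λ k p x∈S → a∉ (∈-projectA-first k₀ x∈S refl))
          (λ k p x∈S → a∉ (∈-projectA-first k₀ x∈S refl)) k₀ pd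
      missing-end (yes a∈) =
        free-copies-not-dominating {c₁ = suc (suc zero)} {suc (suc (suc zero))} (λ ()) no-edge
          (λ k p x∈S → none (first k₀ , a∈ , ∈-projectB-first k₀ x∈S refl))
          (λ k p x∈S → none (first k₀ , a∈ , ∈-projectB-first k₀ x∈S refl)) k₀ pd

  projection-covers : ∀ {S} → PowerDominates I S → CoversAll I (projectA S) (projectB S)
  projection-covers pd i j (_ , _ , e) =
    selects⇒covers (proj₂ (projection-selects pd (proj₁ (edge-index e))))

  power-dominating-set-to-cover :
    ∀ {S} → PowerDominates I S → ∃[ As ] ∃[ Bs ]
      Unique As × Unique Bs × CoversAll I As Bs × suc (length As + length Bs) ≤ length S
  power-dominating-set-to-cover {S} pd =
    deduplicate _≟A_ (projectA S) , deduplicate _≟B_ (projectB S) ,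
    deduplicate-! _≟A_ (projectA S) , deduplicate-! _≟B_ (projectB S) ,
    CoversAll-mono (∈-deduplicate⁺ _≟A_) (∈-deduplicate⁺ _≟B_) (projection-covers pd) ,
    ≤-trans (s≤s (+-mono-≤ (length-deduplicate _≟A_ (projectA S))
                           (length-deduplicate _≟B_ (projectB S))))
            (length-sides-< role S (power-dominating-has-hub pd))

  projectA-Sstar : ∀ As Bs → projectA (Sstar I As Bs) ≡ As
  projectA-Sstar []       []       = refl
  projectA-Sstar []       (_ ∷ Bs) = projectA-Sstar [] Bs
  projectA-Sstar (a ∷ As) Bs       = cong (a ∷_) (projectA-Sstar As Bs)

  projectB-Sstar : ∀ As Bs → projectB (Sstar I As Bs) ≡ Bs
  projectB-Sstar []       []       = refl
  projectB-Sstar []       (b ∷ Bs) = cong (b ∷_) (projectB-Sstar [] Bs)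
  projectB-Sstar (_ ∷ As) Bs       = projectB-Sstar As Bs

  length-Sstar : ∀ As Bs → length (Sstar I As Bs) ≡ suc (length As + length Bs)
  length-Sstar []       []       = refl
  length-Sstar []       (_ ∷ Bs) = cong suc (length-Sstar [] Bs)
  length-Sstar (_ ∷ As) Bs       = cong suc (length-Sstar As Bs)

  -- A repeated node of S* would project to a repeated element of A* or B*.
  Sstar-unique : ∀ {As Bs} → Unique As → Unique Bs → Unique (Sstar I As Bs)
  Sstar-unique {[]}     {[]}     _  _  = ∉⇒Unique-∷ (λ ()) []
  Sstar-unique {[]}     {b ∷ Bs} uA uB@(_ ∷ uBs) =
    ∉⇒Unique-∷ (λ b∈ → Unique[x∷xs]⇒x∉xs uB
                  (subst (b ∈_) (projectB-Sstar [] Bs) (∈-sideB role b∈ refl)))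
               (Sstar-unique uA uBs)
  Sstar-unique {a ∷ As} {Bs}     uA@(_ ∷ uAs) uB =
    ∉⇒Unique-∷ (λ a∈ → Unique[x∷xs]⇒x∉xs uA
                  (subst (a ∈_) (projectA-Sstar As Bs) (∈-sideA role a∈ refl)))
               (Sstar-unique uAs uB)

  nA-∈-Sstar : ∀ {As Bs i a} → (i , a) ∈ As → nA i a ∈ Sstar I As Bs
  nA-∈-Sstar (here refl)  = here refl
  nA-∈-Sstar (there a∈As) = there (nA-∈-Sstar a∈As)

  nB-∈-Sstar : ∀ {As Bs j b} → (j , b) ∈ Bs → nB j b ∈ Sstar I As Bs
  nB-∈-Sstar {_ ∷ As} b∈Bs         = there (nB-∈-Sstar {As} b∈Bs)
  nB-∈-Sstar {[]}     (here refl)  = here refl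
  nB-∈-Sstar {[]}     (there b∈Bs) = there (nB-∈-Sstar {[]} b∈Bs)

  wstar-∈-Sstar : ∀ As Bs → wstar ∈ Sstar I As Bs
  wstar-∈-Sstar []       []       = here refl
  wstar-∈-Sstar []       (_ ∷ Bs) = there (wstar-∈-Sstar [] Bs)
  wstar-∈-Sstar (_ ∷ As) Bs       = there (wstar-∈-Sstar As Bs)

  Sstar-power-dominates : ∀ {As Bs} → CoversAll I As Bs → PowerDominates I (Sstar I As Bs)
  Sstar-power-dominates {As} {Bs} cov =
    power-dominates-if-edges (wstar-∈-Sstar As Bs) λ i j k →
      let k₀ , a∈ , b∈ = covers⇒selects (cov i j (edgeA i j k , edgeB i j k , edge-at i j k))
      in k₀ , nA-∈-Sstar a∈ , nB-∈-Sstar {As} b∈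

lemma1 : (I : MinRep) (As : List (NodeA I)) (Bs : List (NodeB I)) →
    Unique As → Unique Bs →
    OptMinRep I As Bs ⇔ OptPDS I (Sstar I As Bs)
lemma1 I As Bs uA uB = mk⇔ to from
  where
    to : OptMinRep I As Bs → OptPDS I (Sstar I As Bs)
    to (cov , opt) = Sstar-unique I uA uB , Sstar-power-dominates I cov , λ S _ pd →
      let As' , Bs' , uA' , uB' , cov' , smaller = power-dominating-set-to-cover I pd
      in subst (_≤ length S) (sym (length-Sstar I As Bs))
               (≤-trans (s≤s (opt As' Bs' uA' uB' cov')) smaller)

    from : OptPDS I (Sstar I As Bs) → OptMinRep I As Bs
    from (_ , pd , opt) =
      subst₂ (CoversAll I) (projectA-Sstar I As Bs) (projectB-Sstar I As Bs) (projection-covers I pd) ,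
      λ As' Bs' uA' uB' cov' → ≤-pred (subst₂ _≤_ (length-Sstar I As Bs) (length-Sstar I As' Bs')
        (opt (Sstar I As' Bs') (Sstar-unique I uA' uB') (Sstar-power-dominates I cov')))
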